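{- Let $\Gamma$ be a strongly regular graph of type I with parameters $(v,k,\lambda,\mu)$ and restricted eigenvalues $\rho>\sigma$, and let $d$ be a non-negative integer with $d<-\sigma$. If $$\frac12+\frac{d}{\sqrt v+1}<\mathrm{frac}(-\sigma)<\frac34+\frac{\sqrt v-\sqrt{v-2d+5/4}}{2},$$ then $\mathrm{Rab}_{\geq}(\Gamma,d)<\lfloor \mathrm{Haem}_{\geq}(\Gamma,d)\rfloor$.
   Context: A graph is strongly regular with parameters $(v,k,\lambda,\mu)$ if it has $v$ vertices, is $k$-regular, is neither complete nor edgeless, every two adjacent vertices have exactly $\lambda$ common neighbours, and every two distinct non-adjacent vertices have exactly $\mu$ common neighbours. It is of type I (a conference graph) if $(v,k,\lambda,\mu)=(4n+1,2n,n-1,n)$ for some positive integer $n$; then its restricted eigenvalues (the two roots of $t^2-(\lambda-\mu)t-(k-\mu)=0$) are $\rho=(\sqrt v-1)/2$ and $\sigma=(-\sqrt v-1)/2$. For real $x$, $\mathrm{frac}(x)=x-\lfloor x\rfloor$. $\mathrm{Haem}_{\geq}(\Gamma,d)=v\frac{d-\sigma}{k-\sigma}$. The regular adjacency polynomial is $R_\Gamma(x,y,d)=x(x+1)(v-y)-2xyk+(2x+\lambda-\mu+1)yd+y(y-1)\mu-yd^2$; $S_d=\{y\in\{d+1,\dots,v\}: R_\Gamma(x,y,d)\ge0\text{ for all integers }x\}$, and $\mathrm{Rab}_{\geq}(\Gamma,d)=\max S_d$ if $S_d\ne\emptyset$, else $0$. -}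

module Defs where

open import Data.Bool using (Bool; true; false; if_then_else_; _∧_)
open import Data.Nat as ℕ using (ℕ; suc)
open import Data.Fin using (Fin)
open import Data.List using (List; map; allFin)
open import Data.Nat.ListAction using (sum)
open import Data.Integer as ℤ using (ℤ; +_; -_; _+_; _-_; _*_; _<_; _≤_; 0ℤ; 1ℤ)
open import Data.Product using (_×_; ∃; Σ)
open import Data.Sum using (_⊎_)
open import Relation.Nullary using (¬_)
open import Relation.Binary.PropositionalEquality using (_≡_; _≢_)

record Graph (v : ℕ) : Set where
  field
    adj   : Fin v → Fin v → Bool
    sym   : ∀ x y → adj x y ≡ adj y x
    irrefl : ∀ x → adj x x ≡ false

open Graph public

countV : ∀ {v} → (Fin v → Bool) → ℕ
countV {v} p = sum (map (λ w → if p w then 1 else 0) (allFin v))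

degree : ∀ {v} → Graph v → Fin v → ℕ
degree G x = countV (λ w → adj G x w)

commonNbrs : ∀ {v} → Graph v → Fin v → Fin v → ℕ
commonNbrs G x y = countV (λ w → adj G x w ∧ adj G y w)

IsSRG : (v k lam mu : ℕ) → Graph v → Set
IsSRG v k lam mu G =
    (∀ x → degree G x ≡ k)
  × (∃ λ x → ∃ λ y → adj G x y ≡ true)
  × (∃ λ x → ∃ λ y → (x ≢ y) × (adj G x y ≡ false))
  × (∀ x y → adj G x y ≡ true → commonNbrs G x y ≡ lam)
  × (∀ x y → x ≢ y → adj G x y ≡ false → commonNbrs G x y ≡ mu)

-- Exact sign tests for real numbers of the form a + b·√c (a b : ℤ, c : ℕ).

-- a + b√c > 0
Pos : ℤ → ℤ → ℕ → Set
Pos a b c =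
    (0ℤ ≤ a × 0ℤ ≤ b × 0ℤ < a * a + b * b * + c)
  ⊎ (0ℤ ≤ a × b < 0ℤ × b * b * + c < a * a)
  ⊎ (a < 0ℤ × 0ℤ < b × a * a < b * b * + c)

NonNeg : ℤ → ℤ → ℕ → Set
NonNeg a b c = ¬ Pos (- a) (- b) c

-- Quantities of the proposition for a type-I graph with parameters
-- (v,k,λ,μ) = (4n+1, 2n, n-1, n); write t = √v, so
-- ρ = (t-1)/2, σ = (-t-1)/2, -σ = (t+1)/2.

-- d < -σ   ⇔  d < (t+1)/2  ⇔  (1 - 2d) + t > 0
DBelowMinusSigma : (v d : ℕ) → Set
DBelowMinusSigma v d = Pos (1ℤ - + (2 ℕ.* d)) 1ℤ v

-- m = ⌊-σ⌋ :  m ≤ (t+1)/2 < m+1  ⇔  (1-2m) + t ≥ 0  and  (2m+1) - t > 0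
IsFloorMinusSigma : (v : ℕ) → ℤ → Set
IsFloorMinusSigma v m =
  NonNeg (1ℤ - + 2 * m) 1ℤ v × Pos (+ 2 * m + 1ℤ) (- 1ℤ) v

-- With frac(-σ) = (t+1)/2 - m:
-- 1/2 + d/(t+1) < (t+1)/2 - m
--   ⇔ (multiplying by 2(t+1) > 0)  (t+1) + 2d < (t+1)² - 2m(t+1)
--   ⇔ (v - 2d - 2m) + (1 - 2m) t > 0
LowerCond : (v d : ℕ) (m : ℤ) → Set
LowerCond v d m = Pos (+ v - + (2 ℕ.* d) - + 2 * m) (1ℤ - + 2 * m) v

-- (t+1)/2 - m < 3/4 + (t - √(v - 2d + 5/4))/2
--   ⇔ (multiplying by 4)  2t + 2 - 4m < 3 + 2t - √(4v - 8d + 5)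
--   ⇔ (4m + 1) - √(4v - 8d + 5) > 0
-- (4v + 5 - 8d ≥ 0 holds whenever d < -σ, so ∸ does not truncate there.)
UpperCond : (v d : ℕ) (m : ℤ) → Set
UpperCond v d m = Pos (+ 4 * m + 1ℤ) (- 1ℤ) ((4 ℕ.* v ℕ.+ 5) ℕ.∸ (8 ℕ.* d))

-- Haem≥(Γ,d) = v (d-σ)/(k-σ) = v (2d + 1 + t)/(v + t)   (as k = 2n, v = 4n+1).
-- h = ⌊Haem≥⌋ :  h (v+t) ≤ v(2d+1+t) < (h+1)(v+t), i.e.
--   (v(2d+1) - h v) + (v - h) t ≥ 0   and   ((h+1) v - v(2d+1)) + (h+1-v) t > 0
IsFloorHaem : (v d : ℕ) → ℤ → Set
IsFloorHaem v d h =
    NonNeg (+ v * + (2 ℕ.* d ℕ.+ 1) - h * + v) (+ v - h) v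
  × Pos ((h + 1ℤ) * + v - + v * + (2 ℕ.* d ℕ.+ 1)) (h + 1ℤ - + v) v

R : (v k lam mu : ℕ) → ℤ → ℤ → ℤ → ℤ
R v k lam mu x y d =
    x * (x + 1ℤ) * (+ v - y) - + 2 * x * y * + k
  + (+ 2 * x + + lam - + mu + 1ℤ) * y * d
  + y * (y - 1ℤ) * + mu - y * d * d

InS : (v k lam mu d : ℕ) → ℕ → Set
InS v k lam mu d y =
  (suc d ℕ.≤ y) × (y ℕ.≤ v) × (∀ (x : ℤ) → 0ℤ ≤ R v k lam mu x (+ y) (+ d))

IsRab : (v k lam mu d : ℕ) → ℕ → Set
IsRab v k lam mu d r =
    (InS v k lam mu d r × (∀ y → InS v k lam mu d y → y ℕ.≤ r))
  ⊎ ((∀ y → ¬ InS v k lam mu d y) × r ≡ 0)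

{-# OPTIONS --safe #-}
module Submission where

-- Write t = √v and m = ⌊-σ⌋ = ⌊(t+1)/2⌋, so (2m-1)² ≤ v < (2m+1)², i.e. m² - m ≤ n < m² + m.
-- Since v(2d+1+t) - 2(m+d)(v+t) = t((v - 2d - 2m) + (1 - 2m)t), the lower bound on frac(-σ)
-- says exactly that Haem≥ > 2(m+d); hence ⌊Haem≥⌋ ≥ 2(m+d), and it suffices to show that no
-- y ∈ [2(m+d), v] lies in S_d. For type-I parameters R(x,y,d) is a quadratic in x with
-- leading coefficient v - y. At y = 2(m+d) the choice x = m+d gives
-- R = -(m+d)(2m² + m + d - 2n - 1), negative by the upper bound on frac(-σ); at y = v the
-- choice x = 2n gives R = -v(2n-d)²; in between the discriminant exceeds (v-y)², so R is
-- negative at the integer x nearest to the vertex.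

open import Data.Nat as ℕ using (ℕ; zero; suc; z≤n; s≤s; _≥_)
import Data.Nat.Properties as ℕ
open import Data.Integer as ℤ
  using (ℤ; +_; -_; _+_; _-_; _*_; _<_; _≤_; _≤?_; _≟_; 0ℤ; 1ℤ; +≤+; +<+; -<+; -[1+_])
open import Data.Integer.Properties
open import Data.Integer.DivMod using (_/ℕ_; _%ℕ_; a≡a%ℕn+[a/ℕn]*n; n%ℕd<d)
open import Data.Integer.Tactic.RingSolver using (solve-∀)
open import Data.Product using (∃; _×_; _,_; proj₁; proj₂; map₂)
open import Data.Sum using (_⊎_; inj₁; inj₂)
open import Relation.Nullary using (¬_; yes; no; contradiction)
open import Relation.Binary.PropositionalEquality
  using (_≡_; refl; sym; trans; cong; cong₂; subst; subst₂; module ≡-Reasoning)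
open import Defs hiding (sym)

0≤i*j : ∀ {i j} → 0ℤ ≤ i → 0ℤ ≤ j → 0ℤ ≤ i * j
0≤i*j {+ m} {+ n} _ _ = subst (0ℤ ≤_) (pos-* m n) (+≤+ z≤n)

0<i*j : ∀ {i j} → 0ℤ < i → 0ℤ < j → 0ℤ < i * j
0<i*j {+ suc m} {+ suc n} _        _        = +<+ (s≤s z≤n)
0<i*j {+ suc m} {+ zero}  _        (+<+ ())
0<i*j {+ zero}  {_}       (+<+ ()) _

0≤i*i : ∀ i → 0ℤ ≤ i * i
0≤i*i (+ n)    = 0≤i*j {+ n} {+ n} (+≤+ z≤n) (+≤+ z≤n)
0≤i*i -[1+ n ] = +≤+ z≤n

i*i≤j*j : ∀ {i j} → 0ℤ ≤ i → i ≤ j → i * i ≤ j * j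
i*i≤j*j {i} {j} 0≤i i≤j =
  ≤-trans (*-monoʳ-≤-nonNeg i {{ℤ.nonNegative 0≤i}} i≤j)
          (*-monoˡ-≤-nonNeg j {{ℤ.nonNegative (≤-trans 0≤i i≤j)}} i≤j)

i*i<j*j⇒i<j : ∀ {i j} → 0ℤ ≤ j → i * i < j * j → i < j
i*i<j*j⇒i<j 0≤j i*i<j*j = ≰⇒> (λ j≤i → <⇒≱ i*i<j*j (i*i≤j*j 0≤j j≤i))

k*i<0⇒i<0 : ∀ {k i} → 0ℤ ≤ k → k * i < 0ℤ → i < 0ℤ
k*i<0⇒i<0 0≤k k*i<0 = ≰⇒> (λ 0≤i → <⇒≱ k*i<0 (0≤i*j 0≤k 0≤i))

0<j-i⇒i<j : ∀ {i j} → 0ℤ < j - i → i < j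
0<j-i⇒i<j {i} {j} 0<j-i = subst₂ _<_ (+-identityˡ i) (j-i+i≡j j i) (+-monoˡ-< i 0<j-i)
  where
  j-i+i≡j : ∀ j i → j - i + i ≡ j
  j-i+i≡j = solve-∀

i<j⇒0<j-i : ∀ {i j} → i < j → 0ℤ < j - i
i<j⇒0<j-i {i} {j} i<j = subst (_< j - i) (+-inverseʳ i) (+-monoˡ-< (- i) i<j)

pos-4n+1 : ∀ n → + (4 ℕ.* n ℕ.+ 1) ≡ + 4 * + n + 1ℤ
pos-4n+1 n = trans (pos-+ (4 ℕ.* n) 1) (cong (_+ 1ℤ) (pos-* 4 n))

pos-∸ : ∀ {a b} → b ℕ.≤ a → + (a ℕ.∸ b) ≡ + a - + b
pos-∸ {a} {b} b≤a = sym (trans (m-n≡m⊖n a b) (⊖-≥ b≤a))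

0<2m-1 : ∀ {m} → 0ℤ < m → 0ℤ < + 2 * m - 1ℤ
0<2m-1 {m} 0<m =
  subst (0ℤ <_) (m+[m-1]≡2m-1 m) (+-mono-<-≤ 0<m (i≤j⇒0≤j-i (i<j⇒suc[i]≤j 0<m)))
  where
  m+[m-1]≡2m-1 : ∀ m → m + (m - 1ℤ) ≡ + 2 * m - 1ℤ
  m+[m-1]≡2m-1 = solve-∀

2i-1<2j+1⇒i≤j : ∀ {i j} → + 2 * i - 1ℤ < + 2 * j + 1ℤ → i ≤ j
2i-1<2j+1⇒i≤j {i} {j} 2i-1<2j+1 = ≮⇒≥ λ j<i →
  <⇒≱ 2i-1<2j+1 (subst (_≤ + 2 * i - 1ℤ) (2[1+j]-1≡2j+1 j)
                       (+-monoˡ-≤ (- 1ℤ) (*-monoˡ-≤-nonNeg (+ 2) (i<j⇒suc[i]≤j j<i))))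
  where
  2[1+j]-1≡2j+1 : ∀ j → + 2 * (1ℤ + j) - 1ℤ ≡ + 2 * j + 1ℤ
  2[1+j]-1≡2j+1 = solve-∀

Pos-negCoeff : ∀ {a b c} → b < 0ℤ → Pos a b c → 0ℤ ≤ a × b * b * + c < a * a
Pos-negCoeff b<0 (inj₁ (_ , 0≤b , _))         = contradiction b<0 (≤⇒≯ 0≤b)
Pos-negCoeff _   (inj₂ (inj₁ (0≤a , _ , lt))) = 0≤a , lt
Pos-negCoeff b<0 (inj₂ (inj₂ (_ , 0<b , _)))  = contradiction 0<b (<-asym b<0)

Pos-posCoeff : ∀ {a b c} → 0ℤ < b → Pos a b c → 0ℤ ≤ a ⊎ a * a < b * b * + c
Pos-posCoeff _   (inj₁ (0≤a , _ , _))        = inj₁ 0≤a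
Pos-posCoeff 0<b (inj₂ (inj₁ (_ , b<0 , _))) = contradiction 0<b (<-asym b<0)
Pos-posCoeff _   (inj₂ (inj₂ (_ , _ , lt)))  = inj₂ lt

¬Pos-negCoeff : ∀ {a b c} → 0ℤ ≤ a → b < 0ℤ → ¬ Pos a b c → a * a ≤ b * b * + c
¬Pos-negCoeff 0≤a b<0 ¬pos = ≮⇒≥ (λ lt → ¬pos (inj₂ (inj₁ (0≤a , b<0 , lt))))

floorMinusSigma-bounds : ∀ {v m} .{{_ : ℕ.NonZero v}} → IsFloorMinusSigma v m
                       → 0ℤ < m
                       × (+ 2 * m - 1ℤ) * (+ 2 * m - 1ℤ) ≤ + v
                       × + v < (+ 2 * m + 1ℤ) * (+ 2 * m + 1ℤ)
floorMinusSigma-bounds {v} {m} (2m-1≤√v , √v<2m+1) = 0<m , lower , upper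
  where
  decoded = Pos-negCoeff -<+ √v<2m+1
  upper : + v < (+ 2 * m + 1ℤ) * (+ 2 * m + 1ℤ)
  upper = subst (_< (+ 2 * m + 1ℤ) * (+ 2 * m + 1ℤ)) (*-identityˡ (+ v)) (proj₂ decoded)
  0<m : 0ℤ < m
  0<m = *-cancelˡ-<-nonNeg (+ 2) (subst (0ℤ <_) ([2m+1]-1≡2m m) (i<j⇒0<j-i 1<2m+1))
    where
    1<2m+1 : 1ℤ < + 2 * m + 1ℤ
    1<2m+1 = i*i<j*j⇒i<j (proj₁ decoded) (≤-<-trans (+≤+ (ℕ.>-nonZero⁻¹ v)) upper)
    [2m+1]-1≡2m : ∀ m → + 2 * m + 1ℤ - 1ℤ ≡ + 2 * m
    [2m+1]-1≡2m = solve-∀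
  lower : (+ 2 * m - 1ℤ) * (+ 2 * m - 1ℤ) ≤ + v
  lower = subst₂ (λ a c → a * a ≤ c) (-[1-2m]≡2m-1 m) (*-identityˡ (+ v))
    (¬Pos-negCoeff (subst (0ℤ ≤_) (sym (-[1-2m]≡2m-1 m)) (<⇒≤ (0<2m-1 0<m))) -<+ 2m-1≤√v)
    where
    -[1-2m]≡2m-1 : ∀ m → - (1ℤ - + 2 * m) ≡ + 2 * m - 1ℤ
    -[1-2m]≡2m-1 = solve-∀

[2m-1]²≤4n+1⇒m²-m≤n : ∀ {n m} → (+ 2 * m - 1ℤ) * (+ 2 * m - 1ℤ) ≤ + (4 ℕ.* n ℕ.+ 1)
                    → m * m - m ≤ + n
[2m-1]²≤4n+1⇒m²-m≤n {n} {m} [2m-1]²≤v = 0≤i-j⇒j≤i (*-cancelˡ-≤-pos 0ℤ _ (+ 4)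
  (subst (0ℤ ≤_) (v-[2m-1]²≡4[n-[m²-m]] (+ n) m)
         (i≤j⇒0≤j-i (subst ((+ 2 * m - 1ℤ) * (+ 2 * m - 1ℤ) ≤_) (pos-4n+1 n) [2m-1]²≤v))))
  where
  v-[2m-1]²≡4[n-[m²-m]] : ∀ n m →
    + 4 * n + 1ℤ - (+ 2 * m - 1ℤ) * (+ 2 * m - 1ℤ) ≡ + 4 * (n - (m * m - m))
  v-[2m-1]²≡4[n-[m²-m]] = solve-∀

4n+1<[2m+1]²⇒n<m²+m : ∀ {n m} → + (4 ℕ.* n ℕ.+ 1) < (+ 2 * m + 1ℤ) * (+ 2 * m + 1ℤ)
                    → + n < m * m + m
4n+1<[2m+1]²⇒n<m²+m {n} {m} v<[2m+1]² = 0<j-i⇒i<j (*-cancelˡ-<-nonNeg (+ 4)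
  (subst (0ℤ <_) ([2m+1]²-v≡4[m²+m-n] (+ n) m)
         (i<j⇒0<j-i (subst (_< (+ 2 * m + 1ℤ) * (+ 2 * m + 1ℤ)) (pos-4n+1 n) v<[2m+1]²))))
  where
  [2m+1]²-v≡4[m²+m-n] : ∀ n m →
    (+ 2 * m + 1ℤ) * (+ 2 * m + 1ℤ) - (+ 4 * n + 1ℤ) ≡ + 4 * (m * m + m - n)
  [2m+1]²-v≡4[m²+m-n] = solve-∀

m²-m≤n⇒3m≤4n : ∀ {n m} → 1 ℕ.≤ n → 0ℤ < m → m * m - m ≤ + n → + 3 * m ≤ + 4 * + n
m²-m≤n⇒3m≤4n {n} {m} 1≤n 0<m m²-m≤n with m ≟ 1ℤ
... | yes refl = subst (+ 3 ≤_) (pos-* 4 n) (+≤+ (ℕ.≤-trans (ℕ.n≤1+n 3) (ℕ.*-monoʳ-≤ 4 1≤n)))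
... | no m≢1   = 0≤i-j⇒j≤i (subst (0ℤ ≤_) (certificate (+ n) m)
  (+-mono-≤ (0≤i*j {+ 4} (+≤+ z≤n) (i≤j⇒0≤j-i m²-m≤n))
            (0≤i*j (<⇒≤ 0<m) (+-mono-≤ (0≤i*j {+ 4} (+≤+ z≤n) 0≤m-2) (+≤+ z≤n)))))
  where
  0≤m-2 : 0ℤ ≤ m - + 2
  0≤m-2 = i≤j⇒0≤j-i (i<j⇒suc[i]≤j (≤∧≢⇒< (i<j⇒suc[i]≤j 0<m) (λ 1≡m → m≢1 (sym 1≡m))))
  certificate : ∀ n m → + 4 * (n - (m * m - m)) + m * (+ 4 * (m - + 2) + 1ℤ) ≡ + 4 * n - + 3 * m
  certificate = solve-∀

DBelowMinusSigma⇒d≤m : ∀ {v d m} → 0ℤ < m → + v < (+ 2 * m + 1ℤ) * (+ 2 * m + 1ℤ)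
                     → DBelowMinusSigma v d → + d ≤ m
DBelowMinusSigma⇒d≤m {v} {d} {m} 0<m v<[2m+1]² 2d-1<√v =
  2i-1<2j+1⇒i≤j (2d-1<2m+1 (Pos-posCoeff (+<+ (s≤s z≤n)) 2d-1<√v))
  where
  0<2m+1 : 0ℤ < + 2 * m + 1ℤ
  0<2m+1 = +-mono-<-≤ (0<i*j {+ 2} (+<+ (s≤s z≤n)) 0<m) (+≤+ z≤n)
  1-2d≡-[2d-1] : 1ℤ - + (2 ℕ.* d) ≡ - (+ 2 * + d - 1ℤ)
  1-2d≡-[2d-1] = trans (cong (λ e → 1ℤ - e) (pos-* 2 d)) (1-e≡-[e-1] (+ 2 * + d))
    where
    1-e≡-[e-1] : ∀ e → 1ℤ - e ≡ - (e - 1ℤ)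
    1-e≡-[e-1] = solve-∀
  2d-1<2m+1 : 0ℤ ≤ 1ℤ - + (2 ℕ.* d) ⊎ (1ℤ - + (2 ℕ.* d)) * (1ℤ - + (2 ℕ.* d)) < 1ℤ * + v
            → + 2 * + d - 1ℤ < + 2 * m + 1ℤ
  2d-1<2m+1 (inj₁ 0≤1-2d) =
    ≤-<-trans (neg-cancel-≤ (subst (0ℤ ≤_) 1-2d≡-[2d-1] 0≤1-2d)) 0<2m+1
  2d-1<2m+1 (inj₂ [1-2d]²<v) =
    i*i<j*j⇒i<j (<⇒≤ 0<2m+1) (<-trans (subst₂ _<_ square (*-identityˡ (+ v)) [1-2d]²<v) v<[2m+1]²)
    where
    square : (1ℤ - + (2 ℕ.* d)) * (1ℤ - + (2 ℕ.* d)) ≡ (+ 2 * + d - 1ℤ) * (+ 2 * + d - 1ℤ)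
    square = trans (cong (λ e → e * e) 1-2d≡-[2d-1]) (-e*-e≡e*e (+ 2 * + d - 1ℤ))
      where
      -e*-e≡e*e : ∀ e → - e * - e ≡ e * e
      -e*-e≡e*e = solve-∀

UpperCond⇒typeI-bound : ∀ {n d m} → m * m - m ≤ + n → + d ≤ m → UpperCond (4 ℕ.* n ℕ.+ 1) d m
                      → 0ℤ < + 2 * (m * m) + m + + d - + 2 * + n - 1ℤ
UpperCond⇒typeI-bound {n} {d} {m} m²-m≤n d≤m √c<4m+1 = *-cancelˡ-<-nonNeg (+ 8)
  (subst (0ℤ <_) ([4m+1]²-c≡8u (+ n) m (+ d))
         (i<j⇒0<j-i (subst (_< (+ 4 * m + 1ℤ) * (+ 4 * m + 1ℤ)) pos-C∸8d c<[4m+1]²)))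
  where
  C = 4 ℕ.* (4 ℕ.* n ℕ.+ 1) ℕ.+ 5
  C′ = + 4 * (+ 4 * + n + 1ℤ) + + 5
  pos-C : + C ≡ C′
  pos-C = trans (pos-+ (4 ℕ.* (4 ℕ.* n ℕ.+ 1)) 5)
                (cong (_+ + 5) (trans (pos-* 4 (4 ℕ.* n ℕ.+ 1)) (cong (+ 4 *_) (pos-4n+1 n))))
  0≤C-8d : 0ℤ ≤ C′ - + 8 * + d
  0≤C-8d = subst (0ℤ ≤_) (certificate (+ n) m (+ d))
    (+-mono-≤ (+-mono-≤ (0≤i*j {+ 16} (+≤+ z≤n) (i≤j⇒0≤j-i m²-m≤n))
                        (0≤i*j {+ 8} (+≤+ z≤n) (i≤j⇒0≤j-i d≤m)))
              (0≤i*i (+ 4 * m - + 3)))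
    where
    certificate : ∀ n m d →
        + 16 * (n - (m * m - m)) + + 8 * (m - d) + (+ 4 * m - + 3) * (+ 4 * m - + 3)
      ≡ + 4 * (+ 4 * n + 1ℤ) + + 5 - + 8 * d
    certificate = solve-∀
  pos-C∸8d : + (C ℕ.∸ 8 ℕ.* d) ≡ C′ - + 8 * + d
  pos-C∸8d = trans (pos-∸ 8d≤C) (cong₂ _-_ pos-C (pos-* 8 d))
    where
    8d≤C : 8 ℕ.* d ℕ.≤ C
    8d≤C = drop‿+≤+ (subst₂ _≤_ (sym (pos-* 8 d)) (sym pos-C) (0≤i-j⇒j≤i 0≤C-8d))
  c<[4m+1]² : + (C ℕ.∸ 8 ℕ.* d) < (+ 4 * m + 1ℤ) * (+ 4 * m + 1ℤ)
  c<[4m+1]² = subst (_< (+ 4 * m + 1ℤ) * (+ 4 * m + 1ℤ)) (*-identityˡ _)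
                    (proj₂ (Pos-negCoeff -<+ √c<4m+1))
  [4m+1]²-c≡8u : ∀ n m d →
      (+ 4 * m + 1ℤ) * (+ 4 * m + 1ℤ) - (+ 4 * (+ 4 * n + 1ℤ) + + 5 - + 8 * d)
    ≡ + 8 * (+ 2 * (m * m) + m + d - + 2 * n - 1ℤ)
  [4m+1]²-c≡8u = solve-∀

LowerCond-squared : ∀ {v d m} → 0ℤ < m → LowerCond v d m
  → 0ℤ ≤ + v - + 2 * + d - + 2 * m
  × (+ 2 * m - 1ℤ) * (+ 2 * m - 1ℤ) * + v < (+ v - + 2 * + d - + 2 * m) * (+ v - + 2 * + d - + 2 * m)
LowerCond-squared {v} {d} {m} 0<m lowerCond =
  proj₁ decoded , subst (_< A * A) ([1-2m]²v≡[2m-1]²v m (+ v)) (proj₂ decoded)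
  where
  A = + v - + 2 * + d - + 2 * m
  1-2m<0 : 1ℤ - + 2 * m < 0ℤ
  1-2m<0 = subst (_< 0ℤ) (-[2m-1]≡1-2m m) (neg-mono-< (0<2m-1 0<m))
    where
    -[2m-1]≡1-2m : ∀ m → - (+ 2 * m - 1ℤ) ≡ 1ℤ - + 2 * m
    -[2m-1]≡1-2m = solve-∀
  decoded = Pos-negCoeff 1-2m<0
    (subst (λ e → Pos (+ v - e - + 2 * m) (1ℤ - + 2 * m) v) (pos-* 2 d) lowerCond)
  [1-2m]²v≡[2m-1]²v : ∀ m v →
    (1ℤ - + 2 * m) * (1ℤ - + 2 * m) * v ≡ (+ 2 * m - 1ℤ) * (+ 2 * m - 1ℤ) * v
  [1-2m]²v≡[2m-1]²v = solve-∀

floorHaem-squared : ∀ {v d h} .{{_ : ℕ.NonZero v}} → 1ℤ + h < + v → IsFloorHaem v d h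
  → 0ℤ ≤ h - + 2 * + d
  × (+ v - (1ℤ + h)) * (+ v - (1ℤ + h)) < + v * ((h - + 2 * + d) * (h - + 2 * + d))
floorHaem-squared {v} {d} {h} 1+h<v (_ , haem<h+1) = 0≤P , *-cancelˡ-<-nonNeg V v[v-[1+h]]²<v[vP²]
  where
  V = + v
  P = h - + 2 * + d
  1+h-v<0 : h + 1ℤ - V < 0ℤ
  1+h-v<0 = subst (_< 0ℤ) (-[v-[1+h]]≡h+1-v V h) (neg-mono-< (i<j⇒0<j-i 1+h<v))
    where
    -[v-[1+h]]≡h+1-v : ∀ v h → - (v - (1ℤ + h)) ≡ h + 1ℤ - v
    -[v-[1+h]]≡h+1-v = solve-∀
  pos-2d+1 : + (2 ℕ.* d ℕ.+ 1) ≡ + 2 * + d + 1ℤ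
  pos-2d+1 = trans (pos-+ (2 ℕ.* d) 1) (cong (_+ 1ℤ) (pos-* 2 d))
  decoded = Pos-negCoeff 1+h-v<0
    (subst (λ e → Pos ((h + 1ℤ) * V - V * e) (h + 1ℤ - V) v) pos-2d+1 haem<h+1)
  0≤P : 0ℤ ≤ P
  0≤P = *-cancelˡ-≤-pos 0ℤ P V {{ℤ.positive (+<+ (ℕ.>-nonZero⁻¹ v))}}
          (subst₂ _≤_ (sym (*-zeroʳ V)) ([h+1]v-v[2d+1]≡vP V (+ d) h) (proj₁ decoded))
    where
    [h+1]v-v[2d+1]≡vP : ∀ v d h → (h + 1ℤ) * v - v * (+ 2 * d + 1ℤ) ≡ v * (h - + 2 * d)
    [h+1]v-v[2d+1]≡vP = solve-∀
  v[v-[1+h]]²<v[vP²] : V * ((V - (1ℤ + h)) * (V - (1ℤ + h))) < V * (V * (P * P))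
  v[v-[1+h]]²<v[vP²] =
    subst₂ _<_ ([h+1-v]²v≡v[v-[1+h]]² V h) ([[h+1]v-v[2d+1]]²≡v[vP²] V (+ d) h) (proj₂ decoded)
    where
    [h+1-v]²v≡v[v-[1+h]]² : ∀ v h →
      (h + 1ℤ - v) * (h + 1ℤ - v) * v ≡ v * ((v - (1ℤ + h)) * (v - (1ℤ + h)))
    [h+1-v]²v≡v[v-[1+h]]² = solve-∀
    [[h+1]v-v[2d+1]]²≡v[vP²] : ∀ v d h →
        ((h + 1ℤ) * v - v * (+ 2 * d + 1ℤ)) * ((h + 1ℤ) * v - v * (+ 2 * d + 1ℤ))
      ≡ v * (v * ((h - + 2 * d) * (h - + 2 * d)))
    [[h+1]v-v[2d+1]]²≡v[vP²] = solve-∀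

2[m+d]≤floorHaem : ∀ {v d m h} .{{_ : ℕ.NonZero v}} → 0ℤ < m → LowerCond v d m → IsFloorHaem v d h
                 → + 2 * (m + + d) ≤ h
2[m+d]≤floorHaem {v} {d} {m} {h} 0<m lowerCond h-floor =
  ≮⇒≥ λ h<2[m+d] → <-irrefl refl (A²<A² h<2[m+d])
  where
  V = + v
  D = + d
  A = V - + 2 * D - + 2 * m
  P = h - + 2 * D
  lower : 0ℤ ≤ A × (+ 2 * m - 1ℤ) * (+ 2 * m - 1ℤ) * V < A * A
  lower = LowerCond-squared {d = d} 0<m lowerCond
  0<A : 0ℤ < A
  0<A = i*i<j*j⇒i<j (proj₁ lower) (≤-<-trans (0≤i*j (0≤i*i (+ 2 * m - 1ℤ)) (+≤+ z≤n)) (proj₂ lower))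
  A²<A² : h < + 2 * (m + D) → A * A < A * A
  A²<A² h<2[m+d] = begin-strict
    A * A                                  ≤⟨ i*i≤j*j (proj₁ lower) A≤v-[1+h] ⟩
    (V - (1ℤ + h)) * (V - (1ℤ + h))        <⟨ proj₂ upper ⟩
    V * (P * P)                            ≤⟨ *-monoˡ-≤-nonNeg V (i*i≤j*j (proj₁ upper) P≤2m-1) ⟩
    V * ((+ 2 * m - 1ℤ) * (+ 2 * m - 1ℤ))  ≡⟨ *-comm V _ ⟩
    (+ 2 * m - 1ℤ) * (+ 2 * m - 1ℤ) * V    <⟨ proj₂ lower ⟩
    A * A                                  ∎
    where
    open ≤-Reasoning
    slack : 0ℤ ≤ + 2 * (m + D) - (1ℤ + h)
    slack = i≤j⇒0≤j-i (i<j⇒suc[i]≤j h<2[m+d])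
    A≤v-[1+h] : A ≤ V - (1ℤ + h)
    A≤v-[1+h] = 0≤i-j⇒j≤i (subst (0ℤ ≤_) (slack≡v-[1+h]-A V D m h) slack)
      where
      slack≡v-[1+h]-A : ∀ v d m h →
        + 2 * (m + d) - (1ℤ + h) ≡ v - (1ℤ + h) - (v - + 2 * d - + 2 * m)
      slack≡v-[1+h]-A = solve-∀
    P≤2m-1 : P ≤ + 2 * m - 1ℤ
    P≤2m-1 = 0≤i-j⇒j≤i (subst (0ℤ ≤_) (slack≡2m-1-P D m h) slack)
      where
      slack≡2m-1-P : ∀ d m h → + 2 * (m + d) - (1ℤ + h) ≡ + 2 * m - 1ℤ - (h - + 2 * d)
      slack≡2m-1-P = solve-∀
    upper : 0ℤ ≤ P × (V - (1ℤ + h)) * (V - (1ℤ + h)) < V * (P * P)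
    upper = floorHaem-squared {d = d} {h = h} (0<j-i⇒i<j (<-≤-trans 0<A A≤v-[1+h])) h-floor

quadratic : ℤ → ℤ → ℤ → ℤ → ℤ
quadratic a b c x = a * x * x + b * x + c

R≡quadratic : ∀ v k lam mu x y d →
  R v k lam mu x y d
    ≡ quadratic (+ v - y) (+ v - y - + 2 * y * (+ k - d))
                ((+ lam - + mu + 1ℤ) * y * d + y * (y - 1ℤ) * + mu - y * d * d) x
R≡quadratic v k lam mu = expand (+ v) (+ k) (+ lam) (+ mu)
  where
  expand : ∀ v k lam mu x y d →
      x * (x + 1ℤ) * (v - y) - + 2 * x * y * k + (+ 2 * x + lam - mu + 1ℤ) * y * d
    + y * (y - 1ℤ) * mu - y * d * d
    ≡ (v - y) * x * x + (v - y - + 2 * y * (k - d)) * x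
    + ((lam - mu + 1ℤ) * y * d + y * (y - 1ℤ) * mu - y * d * d)
  expand = solve-∀

-- The witness is x = ⌊(a - b)/2a⌋, which puts 2ax + b in (-a, a].
centred-value : ∀ a .{{_ : ℕ.NonZero a}} b
              → ∃ λ x → (+ 2 * + a * x + b) * (+ 2 * + a * x + b) ≤ + a * + a
centred-value (suc a) b = q , subst (λ e → e * e ≤ A * A) (sym 2Aq+b≡A-r) [A-r]²≤A²
  where
  A = + suc a
  q = (A - b) /ℕ (2 ℕ.* suc a)
  r = + ((A - b) %ℕ (2 ℕ.* suc a))
  division : A - b ≡ r + q * (+ 2 * A)
  division = trans (a≡a%ℕn+[a/ℕn]*n (A - b) (2 ℕ.* suc a)) (cong (λ e → r + q * e) (pos-* 2 (suc a)))
  2Aq+b≡A-r : + 2 * A * q + b ≡ A - r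
  2Aq+b≡A-r = begin
    + 2 * A * q + b                         ≡⟨ unfold A b q ⟩
    A - (A - b - q * (+ 2 * A))             ≡⟨ cong (λ e → A - (e - q * (+ 2 * A))) division ⟩
    A - (r + q * (+ 2 * A) - q * (+ 2 * A)) ≡⟨ cancel A r (q * (+ 2 * A)) ⟩
    A - r                                   ∎
    where
    open ≡-Reasoning
    unfold : ∀ A b q → + 2 * A * q + b ≡ A - (A - b - q * (+ 2 * A))
    unfold = solve-∀
    cancel : ∀ A r e → A - (r + e - e) ≡ A - r
    cancel = solve-∀
  r<2A : r < + 2 * A
  r<2A = subst (r <_) (pos-* 2 (suc a)) (+<+ (n%ℕd<d (A - b) (2 ℕ.* suc a)))
  [A-r]²≤A² : (A - r) * (A - r) ≤ A * A
  [A-r]²≤A² = 0≤i-j⇒j≤i (subst (0ℤ ≤_) (r[2A-r]≡A²-[A-r]² A r)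
                                (0≤i*j {r} (+≤+ z≤n) (i≤j⇒0≤j-i (<⇒≤ r<2A))))
    where
    r[2A-r]≡A²-[A-r]² : ∀ A r → r * (+ 2 * A - r) ≡ A * A - (A - r) * (A - r)
    r[2A-r]≡A²-[A-r]² = solve-∀

quadratic-negative : ∀ a .{{_ : ℕ.NonZero a}} b c → 0ℤ < b * b - + 4 * + a * c - + a * + a
                   → ∃ λ x → quadratic (+ a) b c x < 0ℤ
quadratic-negative a b c 0<Δ-a² with centred-value a b
... | x , centred = x , k*i<0⇒i<0 (0≤i*j {+ 4} {+ a} (+≤+ z≤n) (+≤+ z≤n)) 4aq<0
  where
  A = + a
  e = + 2 * A * x + b
  4aq<0 : + 4 * A * quadratic A b c x < 0ℤ
  4aq<0 = subst (_< 0ℤ) (sym (complete-square A b c x))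
    (+-mono-≤-< (subst (e * e - A * A ≤_) (+-inverseʳ (A * A)) (+-monoˡ-≤ (- (A * A)) centred))
                (neg-mono-< 0<Δ-a²))
    where
    complete-square : ∀ a b c x → + 4 * a * (a * x * x + b * x + c)
      ≡ ((+ 2 * a * x + b) * (+ 2 * a * x + b) - a * a) + - (b * b - + 4 * a * c - a * a)
    complete-square = solve-∀

-- R(x,y,d) for (v,k,λ,μ) = (4n+1, 2n, n-1, n); the term (λ-μ+1)yd vanishes.
Rᴵ : ℤ → ℤ → ℤ → ℤ → ℤ
Rᴵ n x y d = quadratic (+ 4 * n + 1ℤ - y) (+ 4 * n + 1ℤ - y - + 2 * y * (+ 2 * n - d))
                       (y * (y - 1ℤ) * n - y * d * d) x

R-typeI : ∀ n₀ x y d → R (4 ℕ.* suc n₀ ℕ.+ 1) (2 ℕ.* suc n₀) n₀ (suc n₀) x y d ≡ Rᴵ (+ suc n₀) x y d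
R-typeI n₀ x y d = begin
  R v k n₀ (suc n₀) x y d              ≡⟨ R≡quadratic v k n₀ (suc n₀) x y d ⟩
  Q (+ v) (+ k) (+ n₀)                 ≡⟨ cong₂ (λ V K → Q V K (+ n₀)) (pos-4n+1 (suc n₀)) (pos-* 2 (suc n₀)) ⟩
  Q (+ 4 * N + 1ℤ) (+ 2 * N) (+ n₀)    ≡⟨ cong (Q (+ 4 * N + 1ℤ) (+ 2 * N)) n₀≡N-1 ⟩
  Q (+ 4 * N + 1ℤ) (+ 2 * N) (N - 1ℤ)  ≡⟨ drop-λ-μ+1 N x y d ⟩
  Rᴵ N x y d                           ∎
  where
  open ≡-Reasoning
  v = 4 ℕ.* suc n₀ ℕ.+ 1
  k = 2 ℕ.* suc n₀
  N = + suc n₀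
  Q : ℤ → ℤ → ℤ → ℤ
  Q V K L = quadratic (V - y) (V - y - + 2 * y * (K - d))
                      ((L - N + 1ℤ) * y * d + y * (y - 1ℤ) * N - y * d * d) x
  n₀≡N-1 : + n₀ ≡ N - 1ℤ
  n₀≡N-1 = trans (i≡1+i-1 (+ n₀)) (cong (_- 1ℤ) (sym (pos-+ 1 n₀)))
    where
    i≡1+i-1 : ∀ i → i ≡ 1ℤ + i - 1ℤ
    i≡1+i-1 = solve-∀
  drop-λ-μ+1 : ∀ n x y d →
    let a = + 4 * n + 1ℤ - y ; b = + 4 * n + 1ℤ - y - + 2 * y * (+ 2 * n - d) in
      a * x * x + b * x + ((n - 1ℤ - n + 1ℤ) * y * d + y * (y - 1ℤ) * n - y * d * d)
    ≡ a * x * x + b * x + (y * (y - 1ℤ) * n - y * d * d)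
  drop-λ-μ+1 = solve-∀

Rᴵ-at-start : ∀ {n m d} → 0ℤ < m + d → 0ℤ < + 2 * (m * m) + m + d - + 2 * n - 1ℤ
            → Rᴵ n (m + d) (+ 2 * (m + d)) d < 0ℤ
Rᴵ-at-start {n} {m} {d} 0<m+d 0<u =
  subst (_< 0ℤ) (sym (value n m d)) (neg-mono-< (0<i*j 0<m+d 0<u))
  where
  value : ∀ n m d →
    let x = m + d ; y = + 2 * (m + d) ; a = + 4 * n + 1ℤ - y ; b = a - + 2 * y * (+ 2 * n - d) in
      a * x * x + b * x + (y * (y - 1ℤ) * n - y * d * d)
    ≡ - ((m + d) * (+ 2 * (m * m) + m + d - + 2 * n - 1ℤ))
  value = solve-∀

Rᴵ-at-end : ∀ {n d} → 0ℤ < n → 0ℤ < + 2 * n - d → Rᴵ n (+ 2 * n) (+ 4 * n + 1ℤ) d < 0ℤ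
Rᴵ-at-end {n} {d} 0<n 0<2n-d =
  subst (_< 0ℤ) (sym (value n d)) (neg-mono-< (0<i*j 0<4n+1 (0<i*j 0<2n-d 0<2n-d)))
  where
  0<4n+1 : 0ℤ < + 4 * n + 1ℤ
  0<4n+1 = +-mono-<-≤ (0<i*j {+ 4} (+<+ (s≤s z≤n)) 0<n) (+≤+ z≤n)
  value : ∀ n d →
    let x = + 2 * n ; y = + 4 * n + 1ℤ ; a = + 4 * n + 1ℤ - y ; b = a - + 2 * y * (+ 2 * n - d) in
      a * x * x + b * x + (y * (y - 1ℤ) * n - y * d * d)
    ≡ - ((+ 4 * n + 1ℤ) * ((+ 2 * n - d) * (+ 2 * n - d)))
  value = solve-∀

-- (Δ - a²)/4y for the quadratic x ↦ Rᴵ n x y d, with leading coefficient a = 4n+1-y and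
-- discriminant Δ.
excessᴵ : ℤ → ℤ → ℤ → ℤ
excessᴵ n d y = n * y * y - d * (+ 4 * n + 1ℤ) * y + (+ 4 * n + 1ℤ) * (d * d + d - n)

Rᴵ-negative-inside : ∀ {n d} y {a} .{{_ : ℕ.NonZero a}} → + 4 * n + 1ℤ - + y ≡ + a
                   → 0ℤ < + y → 0ℤ < excessᴵ n d (+ y) → ∃ λ x → Rᴵ n x (+ y) d < 0ℤ
Rᴵ-negative-inside {n} {d} y {a} v-y≡a 0<y 0<excess =
  subst (λ A → ∃ λ x → quadratic A (A - shift) c x < 0ℤ) (sym v-y≡a)
        (quadratic-negative a (+ a - shift) c 0<Δ-a²)
  where
  Y = + y
  shift = + 2 * Y * (+ 2 * n - d)
  c = Y * (Y - 1ℤ) * n - Y * d * d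
  0<Δ-a² : 0ℤ < (+ a - shift) * (+ a - shift) - + 4 * + a * c - + a * + a
  0<Δ-a² = subst (λ A → 0ℤ < (A - shift) * (A - shift) - + 4 * A * c - A * A) v-y≡a
    (subst (0ℤ <_) (sym (Δ-a²≡4y·excess n d Y)) (0<i*j (0<i*j {+ 4} (+<+ (s≤s z≤n)) 0<y) 0<excess))
    where
    Δ-a²≡4y·excess : ∀ n d y →
      let a = + 4 * n + 1ℤ - y ; b = a - + 2 * y * (+ 2 * n - d) in
        b * b - + 4 * a * (y * (y - 1ℤ) * n - y * d * d) - a * a
      ≡ + 4 * y * (n * y * y - d * (+ 4 * n + 1ℤ) * y + (+ 4 * n + 1ℤ) * (d * d + d - n))
    Δ-a²≡4y·excess = solve-∀

excessᴵ-pos : ∀ {n m d y} → 0ℤ < n → 0ℤ ≤ d → d ≤ m → n < m * m + m → + 3 * m ≤ + 4 * n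
            → + 2 * (m + d) < y → 0ℤ < excessᴵ n d y
excessᴵ-pos {n} {m} {d} {y} 0<n 0≤d d≤m n<m²+m 3m≤4n 2[m+d]<y =
  subst (0ℤ <_) (sym (certificate n m d y))
    (+-mono-≤-< (+-mono-≤ (+-mono-≤ (0≤i*j 0≤4n 0≤E) (0≤i*j 0≤d (+-mono-≤ 0≤4n-3m 0≤m-d)))
                          (0≤i*j 0≤J 0≤slope))
                (0<i*j {+ 4} (+<+ (s≤s z≤n)) 0<n))
  where
  E = m * m + m - (1ℤ + n)
  J = y - (1ℤ + + 2 * (m + d))
  0≤n : 0ℤ ≤ n
  0≤n = <⇒≤ 0<n
  0≤4n : 0ℤ ≤ + 4 * n
  0≤4n = 0≤i*j {+ 4} (+≤+ z≤n) 0≤n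
  0≤E : 0ℤ ≤ E
  0≤E = i≤j⇒0≤j-i (i<j⇒suc[i]≤j n<m²+m)
  0≤J : 0ℤ ≤ J
  0≤J = i≤j⇒0≤j-i (i<j⇒suc[i]≤j 2[m+d]<y)
  0≤4n-3m : 0ℤ ≤ + 4 * n - + 3 * m
  0≤4n-3m = i≤j⇒0≤j-i 3m≤4n
  0≤m-d : 0ℤ ≤ m - d
  0≤m-d = i≤j⇒0≤j-i d≤m
  0≤4[n-1]+3 : 0ℤ ≤ + 4 * (n - 1ℤ) + + 3
  0≤4[n-1]+3 = +-mono-≤ (0≤i*j {+ 4} (+≤+ z≤n) (i≤j⇒0≤j-i (i<j⇒suc[i]≤j 0<n))) (+≤+ z≤n)
  0≤slope : 0ℤ ≤ n * J + + 2 * n + m * (+ 4 * (n - 1ℤ) + + 3) + (m - d)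
  0≤slope = +-mono-≤ (+-mono-≤ (+-mono-≤ (0≤i*j 0≤n 0≤J) (0≤i*j {+ 2} (+≤+ z≤n) 0≤n))
                               (0≤i*j (≤-trans 0≤d d≤m) 0≤4[n-1]+3))
                     0≤m-d
  certificate : ∀ n m d y →
    let J = y - (1ℤ + + 2 * (m + d)) in
      n * y * y - d * (+ 4 * n + 1ℤ) * y + (+ 4 * n + 1ℤ) * (d * d + d - n)
    ≡ + 4 * n * (m * m + m - (1ℤ + n)) + d * ((+ 4 * n - + 3 * m) + (m - d))
    + J * (n * J + + 2 * n + m * (+ 4 * (n - 1ℤ) + + 3) + (m - d)) + + 4 * n
  certificate = solve-∀

Rab-below : ∀ {v k lam mu d r} t → 0ℤ < t
          → (∀ y → t ≤ + y → y ℕ.≤ v → ∃ λ x → R v k lam mu x (+ y) (+ d) < 0ℤ)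
          → IsRab v k lam mu d r → + r < t
Rab-below t 0<t _ (inj₂ (_ , refl)) = 0<t
Rab-below {r = r} t 0<t refute (inj₁ ((_ , r≤v , R≥0) , _)) with t ≤? + r
... | no t≰r = ≰⇒> t≰r
... | yes t≤r with refute r t≤r r≤v
...   | x , R<0 = contradiction (R≥0 x) (<⇒≱ R<0)

typeI-R-negative : ∀ n₀ d {m} → 0ℤ < m → + d ≤ m → + suc n₀ < m * m + m → + 3 * m ≤ + 4 * + suc n₀
  → 0ℤ < + 2 * (m * m) + m + + d - + 2 * + suc n₀ - 1ℤ
  → ∀ y → + 2 * (m + + d) ≤ + y → y ℕ.≤ 4 ℕ.* suc n₀ ℕ.+ 1
  → ∃ λ x → R (4 ℕ.* suc n₀ ℕ.+ 1) (2 ℕ.* suc n₀) n₀ (suc n₀) x (+ y) (+ d) < 0ℤ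
typeI-R-negative n₀ d {m} 0<m d≤m n<m²+m 3m≤4n 0<u y 2[m+d]≤y y≤v =
  map₂ (λ {x} → subst (_< 0ℤ) (sym (R-typeI n₀ x (+ y) D))) Rᴵ-negative
  where
  N = + suc n₀
  D = + d
  0<N : 0ℤ < N
  0<N = +<+ (s≤s z≤n)
  0<m+d : 0ℤ < m + D
  0<m+d = +-mono-<-≤ 0<m (+≤+ z≤n)
  0<2n-d : 0ℤ < + 2 * N - D
  0<2n-d = *-cancelˡ-<-nonNeg (+ 3) (subst (0ℤ <_) (certificate N m D)
    (+-mono-≤-< (i≤j⇒0≤j-i 3m≤4n)
                (+-mono-<-≤ (0<i*j {+ 2} (+<+ (s≤s z≤n)) 0<N) (0≤i*j {+ 3} (+≤+ z≤n) (i≤j⇒0≤j-i d≤m)))))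
    where
    certificate : ∀ n m d → (+ 4 * n - + 3 * m) + (+ 2 * n + + 3 * (m - d)) ≡ + 3 * (+ 2 * n - d)
    certificate = solve-∀
  Rᴵ-negative : ∃ λ x → Rᴵ N x (+ y) D < 0ℤ
  Rᴵ-negative with ℕ.m≤n⇒m<n∨m≡n y≤v | + 2 * (m + D) ≟ + y
  ... | inj₂ y≡v | _ = + 2 * N ,
    subst (λ Y → Rᴵ N (+ 2 * N) Y D < 0ℤ) (trans (sym (pos-4n+1 (suc n₀))) (cong +_ (sym y≡v)))
          (Rᴵ-at-end {N} {D} 0<N 0<2n-d)
  ... | inj₁ _ | yes 2[m+d]≡y = m + D ,
    subst (λ Y → Rᴵ N (m + D) Y D < 0ℤ) 2[m+d]≡y (Rᴵ-at-start {N} {m} {D} 0<m+d 0<u)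
  ... | inj₁ y<v | no 2[m+d]≢y =
    Rᴵ-negative-inside {N} {D} y {{ℕ.>-nonZero (ℕ.m<n⇒0<n∸m y<v)}}
      (trans (cong (_- + y) (sym (pos-4n+1 (suc n₀)))) (sym (pos-∸ (ℕ.<⇒≤ y<v))))
      (<-≤-trans (0<i*j {+ 2} (+<+ (s≤s z≤n)) 0<m+d) 2[m+d]≤y)
      (excessᴵ-pos 0<N (+≤+ z≤n) d≤m n<m²+m 3m≤4n (≤∧≢⇒< 2[m+d]≤y 2[m+d]≢y))

proposition6p4 : (n : ℕ) → n ≥ 1 → (Γ : Graph (4 ℕ.* n ℕ.+ 1))
    → IsSRG (4 ℕ.* n ℕ.+ 1) (2 ℕ.* n) (n ℕ.∸ 1) n Γ
    → (d : ℕ) → DBelowMinusSigma (4 ℕ.* n ℕ.+ 1) d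
    → (m : ℤ) → IsFloorMinusSigma (4 ℕ.* n ℕ.+ 1) m
    → LowerCond (4 ℕ.* n ℕ.+ 1) d m
    → UpperCond (4 ℕ.* n ℕ.+ 1) d m
    → (r : ℕ) → IsRab (4 ℕ.* n ℕ.+ 1) (2 ℕ.* n) (n ℕ.∸ 1) n d r
    → (h : ℤ) → IsFloorHaem (4 ℕ.* n ℕ.+ 1) d h
    → + r < h
proposition6p4 zero () _ _ _ _ _ _ _ _ _ _ _ _
proposition6p4 (suc n₀) n≥1 _ _ d d<-σ m m-floor lowerCond upperCond r rab h h-floor
  with floorMinusSigma-bounds {4 ℕ.* suc n₀ ℕ.+ 1} m-floor
... | 0<m , [2m-1]²≤v , v<[2m+1]² =
  <-≤-trans (Rab-below (+ 2 * (m + + d)) 0<2[m+d] (typeI-R-negative n₀ d 0<m d≤m n<m²+m 3m≤4n 0<u) rab)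
            (2[m+d]≤floorHaem 0<m lowerCond h-floor)
  where
  N = + suc n₀
  0<2[m+d] : 0ℤ < + 2 * (m + + d)
  0<2[m+d] = 0<i*j {+ 2} (+<+ (s≤s z≤n)) (+-mono-<-≤ 0<m (+≤+ z≤n))
  d≤m : + d ≤ m
  d≤m = DBelowMinusSigma⇒d≤m 0<m v<[2m+1]² d<-σ
  m²-m≤n : m * m - m ≤ N
  m²-m≤n = [2m-1]²≤4n+1⇒m²-m≤n {m = m} [2m-1]²≤v
  n<m²+m : N < m * m + m
  n<m²+m = 4n+1<[2m+1]²⇒n<m²+m {m = m} v<[2m+1]²
  3m≤4n : + 3 * m ≤ + 4 * N
  3m≤4n = m²-m≤n⇒3m≤4n n≥1 0<m m²-m≤n
  0<u : 0ℤ < + 2 * (m * m) + m + + d - + 2 * N - 1ℤ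
  0<u = UpperCond⇒typeI-bound m²-m≤n d≤m upperCond
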